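{- If a formula $\varphi$ is provable in $\mathsf{H}\mathbf{EFL}$, then for every finite tree $\mathcal{T}$, every label $\alpha\in\mathcal{T}$ and every agent nominal $n$ not occurring in $\varphi$, the tree sequent $\stackrel{\mathcal{T}}{\Rightarrow}\alpha:@_n\varphi$ (with empty left side) is provable in $\mathsf{T}\mathbf{EFL}$.
   Context: Syntax. Disjoint countably infinite sets $\mathsf{Prop}$ and $\mathsf{Nom}$ (agent nominals). Formulas: $\varphi ::= n \mid p \mid \bot \mid \varphi\to\varphi \mid @_{n}\varphi \mid \mathsf{F}\varphi \mid \Box\varphi$; $\neg,\top,\land,\lor,\leftrightarrow$ usual abbreviations; $\langle\mathsf{F}\rangle\varphi:=\neg\mathsf{F}\neg\varphi$. $@$-prefixed formulas have the form $@_n\varphi$. $\varphi[m/k]$ replaces nominal $k$ by $m$ everywhere. Uniform substitutions map propositional variables to formulas and nominals to nominals. Tree sequents. Labels: natural numbers, and $\alpha\cdot_ni$ (an $n$-child of $\alpha$) for label $\alpha$, nominal $n$, $i\in\mathbb{N}$. A tree: set of labels containing exactly one natural number (root), closed under parents. Labelled formula: $\alpha:\psi$, $\psi$ $@$-prefixed. Tree sequent $\Gamma\stackrel{\mathcal{T}}{\Rightarrow}\Delta$: finite sets of labelled formulas, finite tree containing their labels. Calculus $\mathsf{T}\mathbf{EFL}$ ($\alpha,\beta\in\mathcal{T}$; tree unchanged unless indicated). Initial: $\alpha:@_n\bot,\Gamma\Rightarrow\Delta$; $\alpha:@_n\varphi,\Gamma\Rightarrow\Delta,\alpha:@_n\varphi$.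 Rules (premises / conclusion): $(\mathsf{rep}_{=1})$ $\alpha:@_nm,\alpha:\varphi[n/k],\Gamma\Rightarrow\Delta$ / $\alpha:@_nm,\alpha:\varphi[m/k],\Gamma\Rightarrow\Delta$; $(\mathsf{rep}_{=2})$ $\alpha:@_nm,\alpha:\varphi[m/k],\Gamma\Rightarrow\Delta$ / $\alpha:@_nm,\alpha:\varphi[n/k],\Gamma\Rightarrow\Delta$; $(\mathsf{ref}_=)$ $\alpha:@_nn,\Gamma\Rightarrow\Delta$ / $\Gamma\Rightarrow\Delta$; $(\mathsf{rigid}_=)$ $\beta:@_nm,\Gamma\Rightarrow\Delta$ / $\alpha:@_nm,\Gamma\Rightarrow\Delta$; $(\to R)$ $\alpha:@_n\varphi,\Gamma\Rightarrow\Delta,\alpha:@_n\psi$ / $\Gamma\Rightarrow\Delta,\alpha:@_n(\varphi\to\psi)$; $(\to L)$ $\Gamma\Rightarrow\Delta,\alpha:@_n\varphi$ and $\alpha:@_n\psi,\Gamma\Rightarrow\Delta$ / $\alpha:@_n(\varphi\to\psi),\Gamma\Rightarrow\Delta$; $(@R)$ $\Gamma\Rightarrow\Delta,\alpha:@_m\varphi$ / $\Gamma\Rightarrow\Delta,\alpha:@_n@_m\varphi$; $(@L)$ $\alpha:@_m\varphi,\Gamma\Rightarrow\Delta$ / $\alpha:@_n@_m\varphi,\Gamma\Rightarrow\Delta$; $(\mathsf{F}R)$ $\alpha:@_n\langle\mathsf{F}\rangle m,\Gamma\Rightarrow\Delta,\alpha:@_m\varphi$ / $\Gamma\Rightarrow\Delta,\alpha:@_n\mathsf{F}\varphi$,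 $m$ not in the conclusion; $(\mathsf{F}L)$ $\Gamma\Rightarrow\Delta,\alpha:@_n\langle\mathsf{F}\rangle m$ and $\alpha:@_m\varphi,\Gamma\Rightarrow\Delta$ / $\alpha:@_n\mathsf{F}\varphi,\Gamma\Rightarrow\Delta$; $(\Box R)$ $\Gamma\stackrel{\mathcal{T}\cup\{\alpha\cdot_ni\}}{\Rightarrow}\Delta,\alpha\cdot_ni:@_n\varphi$ / $\Gamma\stackrel{\mathcal{T}}{\Rightarrow}\Delta,\alpha:@_n\Box\varphi$, $i$ fresh in the conclusion; $(\Box L)$ $\beta:@_n\varphi,\Gamma\Rightarrow\Delta$ / $\alpha:@_n\Box\varphi,\Gamma\Rightarrow\Delta$, $\beta$ an $n$-child of $\alpha$; $(w\mathsf{lab})$ $\Gamma\stackrel{\mathcal{T}}{\Rightarrow}\Delta$ / $\Gamma\stackrel{\mathcal{T}\cup\{\alpha\}}{\Rightarrow}\Delta$ if $\mathcal{T}\cup\{\alpha\}$ is a tree; $(Cut)$ $\Gamma\Rightarrow\Delta,\alpha:@_n\varphi$ and $\alpha:@_n\varphi,\Pi\Rightarrow\Sigma$ / $\Gamma,\Pi\Rightarrow\Delta,\Sigma$. Hilbert system $\mathsf{H}\mathbf{EFL}$. Necessity forms: $\#$; $\varphi\to L$; $@_n\Box L$ for necessity form $L$; $L(\varphi)$ replaces $\#$ by $\varphi$. Axioms ($p,q\in\mathsf{Prop}$, $n,m\in\mathsf{Nom}$): propositional tautologies; $\Box(p\to q)\to(\Box p\to\Box q)$; $\mathsf{F}(p\to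 q)\to(\mathsf{F}p\to\mathsf{F}q)$; $@_n(p\to q)\to(@_np\to@_nq)$; $@_nn$; $\neg@_np\leftrightarrow@_n\neg p$; $@_np\to(n\to p)$; $@_n@_mp\to@_mp$; $@_np\to\mathsf{F}@_np$; $@_n\Box@_np\leftrightarrow@_n\Box p$; $@_nm\to\Box@_nm$; $\neg@_nm\to\Box\neg@_nm$. Rules: modus ponens; from $\varphi$ infer $\Box\varphi$, $\mathsf{F}\varphi$, $@_n\varphi$; uniform substitution; from $n\to\varphi$ infer $\varphi$ if $n$ does not occur in $\varphi$; from $L(@_n\langle\mathsf{F}\rangle m\to@_m\varphi)$ infer $L(@_n\mathsf{F}\varphi)$ if $m$ does not occur in $L(@_n\mathsf{F}\varphi)$. -}

module Defs where

open import Data.Nat using (ℕ; _≡ᵇ_)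
open import Data.Bool using (Bool; true; false; if_then_else_; not; _∨_)
open import Data.List using (List; []; _∷_; _++_)
open import Data.List.Membership.Propositional using (_∈_; _∉_)
open import Data.List.Relation.Binary.Subset.Propositional using (_⊆_)
open import Data.List.Relation.Unary.All using (All)
open import Data.Product using (_×_; Σ; ∃; ∃-syntax; _,_)
open import Relation.Binary.PropositionalEquality using (_≡_)

Nom : Set
Nom = ℕ

PropVar : Set
PropVar = ℕ

infixr 5 _⇒_

data Fm : Set where
  nom  : Nom → Fm
  var  : PropVar → Fm
  ⊥f   : Fm
  _⇒_  : Fm → Fm → Fm
  at   : Nom → Fm → Fm
  F    : Fm → Fm
  □    : Fm → Fm

¬f : Fm → Fm
¬f φ = φ ⇒ ⊥f

⊤f : Fm
⊤f = ¬f ⊥f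

_∧f_ : Fm → Fm → Fm
φ ∧f ψ = ¬f (φ ⇒ ¬f ψ)

_∨f_ : Fm → Fm → Fm
φ ∨f ψ = ¬f φ ⇒ ψ

_⇔f_ : Fm → Fm → Fm
φ ⇔f ψ = (φ ⇒ ψ) ∧f (ψ ⇒ φ)

⟨F⟩ : Fm → Fm
⟨F⟩ φ = ¬f (F (¬f φ))

rnN : Nom → Nom → Nom → Nom
rnN m k j = if j ≡ᵇ k then m else j

_[_/_] : Fm → Nom → Nom → Fm
nom j     [ m / k ] = nom (rnN m k j)
var p     [ m / k ] = var p
⊥f        [ m / k ] = ⊥f
(φ ⇒ ψ)   [ m / k ] = (φ [ m / k ]) ⇒ (ψ [ m / k ])
at j φ    [ m / k ] = at (rnN m k j) (φ [ m / k ])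
F φ       [ m / k ] = F (φ [ m / k ])
□ φ       [ m / k ] = □ (φ [ m / k ])

occ : Nom → Fm → Bool
occ n (nom j)  = j ≡ᵇ n
occ n (var p)  = false
occ n ⊥f       = false
occ n (φ ⇒ ψ)  = occ n φ ∨ occ n ψ
occ n (at j φ) = (j ≡ᵇ n) ∨ occ n φ
occ n (F φ)    = occ n φ
occ n (□ φ)    = occ n φ

NotIn : Nom → Fm → Set
NotIn n φ = occ n φ ≡ false

usub : (PropVar → Fm) → (Nom → Nom) → Fm → Fm
usub σ τ (nom j)  = nom (τ j)
usub σ τ (var p)  = σ p
usub σ τ ⊥f       = ⊥f
usub σ τ (φ ⇒ ψ)  = usub σ τ φ ⇒ usub σ τ ψ
usub σ τ (at j φ) = at (τ j) (usub σ τ φ)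
usub σ τ (F φ)    = F (usub σ τ φ)
usub σ τ (□ φ)    = □ (usub σ τ φ)

-- Propositional tautologies: true under every Boolean valuation of the
-- formulas that are not built by ⊥ / → (i.e. tautology instances).
evalB : (Fm → Bool) → Fm → Bool
evalB v ⊥f      = false
evalB v (φ ⇒ ψ) = not (evalB v φ) ∨ evalB v ψ
evalB v φ       = v φ

Taut : Fm → Set
Taut φ = (v : Fm → Bool) → evalB v φ ≡ true

data NForm : Set where
  hole  : NForm
  imp   : Fm → NForm → NForm
  atBox : Nom → NForm → NForm

fill : NForm → Fm → Fm
fill hole        φ = φ
fill (imp ψ L)   φ = ψ ⇒ fill L φ
fill (atBox n L) φ = at n (□ (fill L φ))

data HEFL : Fm → Set where
  ax-taut   : ∀ {φ} → Taut φ → HEFL φ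
  ax-K□     : ∀ p q → HEFL (□ (var p ⇒ var q) ⇒ (□ (var p) ⇒ □ (var q)))
  ax-KF     : ∀ p q → HEFL (F (var p ⇒ var q) ⇒ (F (var p) ⇒ F (var q)))
  ax-Kat     : ∀ n p q → HEFL (at n (var p ⇒ var q) ⇒ (at n (var p) ⇒ at n (var q)))
  ax-ref    : ∀ n → HEFL (at n (nom n))
  ax-selfd  : ∀ n p → HEFL (¬f (at n (var p)) ⇔f at n (¬f (var p)))
  ax-intro  : ∀ n p → HEFL (at n (var p) ⇒ (nom n ⇒ var p))
  ax-agree  : ∀ n m p → HEFL (at n (at m (var p)) ⇒ at m (var p))
  ax-back   : ∀ n p → HEFL (at n (var p) ⇒ F (at n (var p)))
  ax-at□     : ∀ n p → HEFL (at n (□ (at n (var p))) ⇔f at n (□ (var p)))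
  ax-rig+   : ∀ n m → HEFL (at n (nom m) ⇒ □ (at n (nom m)))
  ax-rig-   : ∀ n m → HEFL (¬f (at n (nom m)) ⇒ □ (¬f (at n (nom m))))
  r-mp      : ∀ {φ ψ} → HEFL (φ ⇒ ψ) → HEFL φ → HEFL ψ
  r-nec□    : ∀ {φ} → HEFL φ → HEFL (□ φ)
  r-necF    : ∀ {φ} → HEFL φ → HEFL (F φ)
  r-necat    : ∀ {φ} n → HEFL φ → HEFL (at n φ)
  r-subst   : ∀ {φ} σ τ → HEFL φ → HEFL (usub σ τ φ)
  r-name    : ∀ {φ} n → NotIn n φ → HEFL (nom n ⇒ φ) → HEFL φ
  r-bg      : ∀ L n m φ → NotIn m (fill L (at n (F φ)))
            → HEFL (fill L (at n (⟨F⟩ (nom m)) ⇒ at m φ))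
            → HEFL (fill L (at n (F φ)))

data Label : Set where
  rootL : ℕ → Label
  child : Label → Nom → ℕ → Label

occL : Nom → Label → Bool
occL n (rootL k)     = false
occL n (child α m i) = (m ≡ᵇ n) ∨ occL n α

-- A finite tree is given by a list of labels (read as a finite set).
IsTree : List Label → Set
IsTree T = (∃[ r ] (rootL r ∈ T × (∀ k → rootL k ∈ T → k ≡ r)))
         × (∀ α n i → child α n i ∈ T → α ∈ T)

-- Labelled formulas  α : @_n φ  (every labelled formula is @-prefixed)
record LF : Set where
  constructor _∶at_,_
  field
    lbl : Label
    nm  : Nom
    fm  : Fm
open LF public

lfSub : LF → Nom → Nom → LF
lfSub (α ∶at j , χ) m k = α ∶at rnN m k j , (χ [ m / k ])

occLF : Nom → LF → Bool
occLF n (α ∶at j , χ) = occL n α ∨ occ n (at j χ)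

FreshNom : Nom → List LF → List Label → List LF → Set
FreshNom m Γ T Δ = All (λ x → occLF m x ≡ false) Γ
                 × All (λ x → occLF m x ≡ false) Δ
                 × All (λ α → occL m α ≡ false) T

_≈_ : {A : Set} → List A → List A → Set
xs ≈ ys = (xs ⊆ ys) × (ys ⊆ xs)

TreeSeq : List LF → List Label → List LF → Set
TreeSeq Γ T Δ = IsTree T × All (λ x → lbl x ∈ T) Γ × All (λ x → lbl x ∈ T) Δ

-- Sequents are finite sets represented as lists; the rule
-- `set` closes derivability under equality of the underlying sets.

data TE : List LF → List Label → List LF → Set where
  set    : ∀ {Γ Γ' T T' Δ Δ'} → TreeSeq Γ' T' Δ' → Γ ≈ Γ' → T ≈ T' → Δ ≈ Δ'
         → TE Γ T Δ → TE Γ' T' Δ'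
  init⊥  : ∀ {Γ T Δ α n} → TreeSeq ((α ∶at n , ⊥f) ∷ Γ) T Δ
         → TE ((α ∶at n , ⊥f) ∷ Γ) T Δ
  init   : ∀ {Γ T Δ α n φ} → TreeSeq ((α ∶at n , φ) ∷ Γ) T ((α ∶at n , φ) ∷ Δ)
         → TE ((α ∶at n , φ) ∷ Γ) T ((α ∶at n , φ) ∷ Δ)
  rep=1  : ∀ {Γ T Δ α n m k} (ψ : LF) → lbl ψ ≡ α
         → TreeSeq ((α ∶at n , nom m) ∷ lfSub ψ m k ∷ Γ) T Δ
         → TE ((α ∶at n , nom m) ∷ lfSub ψ n k ∷ Γ) T Δ
         → TE ((α ∶at n , nom m) ∷ lfSub ψ m k ∷ Γ) T Δ
  rep=2  : ∀ {Γ T Δ α n m k} (ψ : LF) → lbl ψ ≡ α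
         → TreeSeq ((α ∶at n , nom m) ∷ lfSub ψ n k ∷ Γ) T Δ
         → TE ((α ∶at n , nom m) ∷ lfSub ψ m k ∷ Γ) T Δ
         → TE ((α ∶at n , nom m) ∷ lfSub ψ n k ∷ Γ) T Δ
  ref=   : ∀ {Γ T Δ α n} → TreeSeq Γ T Δ
         → TE ((α ∶at n , nom n) ∷ Γ) T Δ → TE Γ T Δ
  rigid= : ∀ {Γ T Δ α β n m} → TreeSeq ((α ∶at n , nom m) ∷ Γ) T Δ → β ∈ T
         → TE ((β ∶at n , nom m) ∷ Γ) T Δ → TE ((α ∶at n , nom m) ∷ Γ) T Δ
  →R     : ∀ {Γ T Δ α n φ ψ} → TreeSeq Γ T ((α ∶at n , (φ ⇒ ψ)) ∷ Δ)
         → TE ((α ∶at n , φ) ∷ Γ) T ((α ∶at n , ψ) ∷ Δ)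
         → TE Γ T ((α ∶at n , (φ ⇒ ψ)) ∷ Δ)
  →L     : ∀ {Γ T Δ α n φ ψ} → TreeSeq ((α ∶at n , (φ ⇒ ψ)) ∷ Γ) T Δ
         → TE Γ T ((α ∶at n , φ) ∷ Δ) → TE ((α ∶at n , ψ) ∷ Γ) T Δ
         → TE ((α ∶at n , (φ ⇒ ψ)) ∷ Γ) T Δ
  atR     : ∀ {Γ T Δ α n m φ} → TreeSeq Γ T ((α ∶at n , at m φ) ∷ Δ)
         → TE Γ T ((α ∶at m , φ) ∷ Δ) → TE Γ T ((α ∶at n , at m φ) ∷ Δ)
  atL     : ∀ {Γ T Δ α n m φ} → TreeSeq ((α ∶at n , at m φ) ∷ Γ) T Δ
         → TE ((α ∶at m , φ) ∷ Γ) T Δ → TE ((α ∶at n , at m φ) ∷ Γ) T Δ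
  FR     : ∀ {Γ T Δ α n m φ} → TreeSeq Γ T ((α ∶at n , F φ) ∷ Δ)
         → FreshNom m Γ T ((α ∶at n , F φ) ∷ Δ)
         → TE ((α ∶at n , ⟨F⟩ (nom m)) ∷ Γ) T ((α ∶at m , φ) ∷ Δ)
         → TE Γ T ((α ∶at n , F φ) ∷ Δ)
  FL     : ∀ {Γ T Δ α n m φ} → TreeSeq ((α ∶at n , F φ) ∷ Γ) T Δ
         → TE Γ T ((α ∶at n , ⟨F⟩ (nom m)) ∷ Δ)
         → TE ((α ∶at m , φ) ∷ Γ) T Δ
         → TE ((α ∶at n , F φ) ∷ Γ) T Δ
  □R     : ∀ {Γ T Δ α n i φ} → TreeSeq Γ T ((α ∶at n , □ φ) ∷ Δ)
         → child α n i ∉ T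
         → TE Γ (child α n i ∷ T) ((child α n i ∶at n , φ) ∷ Δ)
         → TE Γ T ((α ∶at n , □ φ) ∷ Δ)
  □L     : ∀ {Γ T Δ α n i φ} → TreeSeq ((α ∶at n , □ φ) ∷ Γ) T Δ
         → child α n i ∈ T
         → TE ((child α n i ∶at n , φ) ∷ Γ) T Δ
         → TE ((α ∶at n , □ φ) ∷ Γ) T Δ
  wlab   : ∀ {Γ T Δ α} → TreeSeq Γ (α ∷ T) Δ
         → TE Γ T Δ → TE Γ (α ∷ T) Δ
  cut    : ∀ {Γ Π T Δ Σ α n φ} → TreeSeq (Γ ++ Π) T (Δ ++ Σ)
         → TE Γ T ((α ∶at n , φ) ∷ Δ) → TE ((α ∶at n , φ) ∷ Π) T Σ
         → TE (Γ ++ Π) T (Δ ++ Σ)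

-- Induction on H EFL derivations, strengthened to cover every uniform
-- substitution instance of a theorem (which absorbs the substitution rule) and
-- to derive α : @_k φ for every tree, label and nominal k.  The axioms have
-- short cut-free derivations; tautologies follow from Kalmár's lemma, taking
-- the formulas not built by ⊥ and → as atoms and cutting the atoms away one at
-- a time.  Necessitation for □ and F uses a fresh child and a fresh nominal.
-- The naming rule, instantiated at k, becomes modus ponens against the
-- derivable α : @_k k.  The Barcan-like rule is admissible because →R, @R and
-- □R are invertible by cut: unwinding the necessity form, entering a fresh
-- child at each @_j □, exposes @_n F φ, and its premise holds in particular
-- for the fresh witness FR chooses.
module Submission where

open import Defs
open import Data.List using (List; []; _∷_)
open import Data.List.Membership.Propositional using (_∈_)

open import Data.Bool using (Bool; true; false; not; _∨_; if_then_else_)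
open import Data.Bool.Properties using (∨-conicalˡ; ∨-conicalʳ)
open import Data.Empty using (⊥-elim)
open import Data.List using (_++_; map; foldr)
open import Data.List.Membership.Propositional using (_∉_)
open import Data.List.Membership.Propositional.Properties using (∈-++⁻; ∈-++⁺ˡ; ∈-++⁺ʳ; ∈-map⁺)
import Data.List.Membership.DecPropositional as DecMembership
open import Data.List.Relation.Binary.Permutation.Propositional using (_↭_; ↭-refl; ↭-prep; ↭-swap; ↭-sym; ↭-trans)
open import Data.List.Relation.Binary.Subset.Propositional using (_⊆_)
open import Data.List.Relation.Binary.Subset.Propositional.Properties using (⊆-refl; ⊆-reflexive-↭; xs⊆x∷xs; xs⊆xs++ys; All-resp-⊇)
open import Data.List.Relation.Unary.All as All using (All; []; _∷_)
import Data.List.Relation.Unary.All.Properties as All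
open import Data.List.Relation.Unary.Any using (here; there)
open import Data.Nat as ℕ using (ℕ; zero; suc; _≡ᵇ_; _⊔_; _<_; s≤s)
open import Data.Nat.Properties using (≤-refl; <-irrefl; m≤m⊔n; m≤n⊔m; m⊔n<o⇒m<o; m⊔n<o⇒n<o)
open import Data.Product using (_×_; _,_; proj₁; proj₂; uncurry)
open import Data.Sum using (_⊎_; inj₁; inj₂; [_,_]′)
open import Function using (id; _∘_)
open import Relation.Binary.Definitions using (DecidableEquality)
open import Relation.Binary.PropositionalEquality using (_≡_; refl; sym; trans; cong; cong₂; subst; module ≡-Reasoning)
open import Relation.Nullary using (yes; no; does)
open import Relation.Nullary.Decidable using (map′; _×-dec_)

private
  variable
    A : Set
    xs ys : List A
    a b : A
    x y : LF
    Γ Γ′ Π Δ Δ′ : List LF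
    T : List Label
    α : Label
    i : ℕ
    j k m n : Nom
    φ ψ : Fm

≈-refl : xs ≈ xs
≈-refl = ⊆-refl , ⊆-refl

≈-trans : {zs : List A} → xs ≈ ys → ys ≈ zs → xs ≈ zs
≈-trans (p , q) (p′ , q′) = p′ ∘ p , q ∘ q′

↭⇒≈ : xs ↭ ys → xs ≈ ys
↭⇒≈ p = ⊆-reflexive-↭ p , ⊆-reflexive-↭ (↭-sym p)

swap-≈ : (a ∷ b ∷ xs) ≈ (b ∷ a ∷ xs)
swap-≈ = ↭⇒≈ (↭-swap _ _ ↭-refl)

rotate-≈ : {c : A} → (a ∷ b ∷ c ∷ xs) ≈ (b ∷ c ∷ a ∷ xs)
rotate-≈ = ↭⇒≈ (↭-trans (↭-swap _ _ ↭-refl) (↭-prep _ (↭-swap _ _ ↭-refl)))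

absorb-≈ : a ∈ xs → (a ∷ xs) ≈ xs
absorb-≈ a∈xs = (λ { (here refl) → a∈xs ; (there p) → p }) , there

++-⊆ : {zs : List A} → xs ⊆ zs → ys ⊆ zs → xs ++ ys ⊆ zs
++-⊆ {xs = xs} p q = [ p , q ]′ ∘ ∈-++⁻ xs

++-absorbˡ-≈ : xs ⊆ ys → (xs ++ ys) ≈ ys
++-absorbˡ-≈ {xs = xs} p = ++-⊆ p ⊆-refl , ∈-++⁺ʳ xs

++-absorbʳ-≈ : ys ⊆ xs → (xs ++ ys) ≈ xs
++-absorbʳ-≈ p = ++-⊆ ⊆-refl p , ∈-++⁺ˡ

++-comm-≈ : (xs ++ ys) ≈ (ys ++ xs)
++-comm-≈ {xs = xs} {ys = ys} = comm xs ys , comm ys xs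
  where
  comm : ∀ us vs → us ++ vs ⊆ vs ++ us
  comm us vs = ++-⊆ (∈-++⁺ʳ vs) ∈-++⁺ˡ

LabelsIn : List Label → List LF → Set
LabelsIn T Γ = All (λ x → lbl x ∈ T) Γ

treeSequent : TE Γ T Δ → TreeSeq Γ T Δ
treeSequent (set ts _ _ _ _) = ts
treeSequent (init⊥ ts)       = ts
treeSequent (init ts)        = ts
treeSequent (rep=1 _ _ ts _) = ts
treeSequent (rep=2 _ _ ts _) = ts
treeSequent (ref= ts _)      = ts
treeSequent (rigid= ts _ _)  = ts
treeSequent (→R ts _)        = ts
treeSequent (→L ts _ _)      = ts
treeSequent (atR ts _)       = ts
treeSequent (atL ts _)       = ts
treeSequent (FR ts _ _)      = ts
treeSequent (FL ts _ _)      = ts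
treeSequent (□R ts _ _)      = ts
treeSequent (□L ts _ _)      = ts
treeSequent (wlab ts _)      = ts
treeSequent (cut ts _ _)     = ts

tree : TE Γ T Δ → IsTree T
tree = proj₁ ∘ treeSequent

antecedentLabels : TE Γ T Δ → LabelsIn T Γ
antecedentLabels = proj₁ ∘ proj₂ ∘ treeSequent

succedentLabels : TE Γ T Δ → LabelsIn T Δ
succedentLabels = proj₂ ∘ proj₂ ∘ treeSequent

replaceHead : LabelsIn T ((α ∶at n , φ) ∷ Δ) → LabelsIn T ((α ∶at m , ψ) ∷ Δ)
replaceHead (α∈T ∷ ℓ) = α∈T ∷ ℓ

init′ : IsTree T → α ∈ T → LabelsIn T Γ → LabelsIn T Δ
      → TE ((α ∶at n , φ) ∷ Γ) T ((α ∶at n , φ) ∷ Δ)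
init′ t α∈T ℓΓ ℓΔ = init (t , α∈T ∷ ℓΓ , α∈T ∷ ℓΔ)

init⊥′ : IsTree T → α ∈ T → LabelsIn T Γ → LabelsIn T Δ
       → TE ((α ∶at n , ⊥f) ∷ Γ) T Δ
init⊥′ t α∈T ℓΓ ℓΔ = init⊥ (t , α∈T ∷ ℓΓ , ℓΔ)

ref=′ : TE ((α ∶at n , nom n) ∷ Γ) T Δ → TE Γ T Δ
ref=′ d = ref= (tree d , All.tail (antecedentLabels d) , succedentLabels d) d

rigid=′ : ∀ {β} → α ∈ T → β ∈ T
        → TE ((β ∶at n , nom m) ∷ Γ) T Δ → TE ((α ∶at n , nom m) ∷ Γ) T Δ
rigid=′ α∈T β∈T d = rigid= (tree d , α∈T ∷ All.tail (antecedentLabels d) , succedentLabels d) β∈T d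

→R′ : TE ((α ∶at n , φ) ∷ Γ) T ((α ∶at n , ψ) ∷ Δ) → TE Γ T ((α ∶at n , (φ ⇒ ψ)) ∷ Δ)
→R′ d = →R (tree d , All.tail (antecedentLabels d) , replaceHead (succedentLabels d)) d

→L′ : TE Γ T ((α ∶at n , φ) ∷ Δ) → TE ((α ∶at n , ψ) ∷ Γ) T Δ
    → TE ((α ∶at n , (φ ⇒ ψ)) ∷ Γ) T Δ
→L′ d e = →L (tree e , replaceHead (antecedentLabels e) , succedentLabels e) d e

atR′ : TE Γ T ((α ∶at m , φ) ∷ Δ) → TE Γ T ((α ∶at n , at m φ) ∷ Δ)
atR′ d = atR (tree d , antecedentLabels d , replaceHead (succedentLabels d)) d

atL′ : TE ((α ∶at m , φ) ∷ Γ) T Δ → TE ((α ∶at n , at m φ) ∷ Γ) T Δ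
atL′ d = atL (tree d , replaceHead (antecedentLabels d) , succedentLabels d) d

FL′ : TE Γ T ((α ∶at n , ⟨F⟩ (nom m)) ∷ Δ) → TE ((α ∶at m , φ) ∷ Γ) T Δ
    → TE ((α ∶at n , F φ) ∷ Γ) T Δ
FL′ d e = FL (tree e , replaceHead (antecedentLabels e) , succedentLabels e) d e

□L′ : α ∈ T → child α n i ∈ T → TE ((child α n i ∶at n , φ) ∷ Γ) T Δ
    → TE ((α ∶at n , □ φ) ∷ Γ) T Δ
□L′ α∈T β∈T d = □L (tree d , α∈T ∷ All.tail (antecedentLabels d) , succedentLabels d) β∈T d

wlab′ : IsTree (α ∷ T) → TE Γ T Δ → TE Γ (α ∷ T) Δ
wlab′ t d = wlab (t , All.map there (antecedentLabels d) , All.map there (succedentLabels d)) d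

cut′ : TE Γ T (x ∷ Δ) → TE (x ∷ Π) T Δ′ → TE (Γ ++ Π) T (Δ ++ Δ′)
cut′ d e = cut (tree d , All.++⁺ (antecedentLabels d) (All.tail (antecedentLabels e))
                       , All.++⁺ (All.tail (succedentLabels d)) (succedentLabels e)) d e

reorder : Γ ≈ Γ′ → Δ ≈ Δ′ → TE Γ T Δ → TE Γ′ T Δ′
reorder Γ≈Γ′ Δ≈Δ′ d =
  set (tree d , All-resp-⊇ (proj₂ Γ≈Γ′) (antecedentLabels d) , All-resp-⊇ (proj₂ Δ≈Δ′) (succedentLabels d))
    Γ≈Γ′ ≈-refl Δ≈Δ′ d

exchangeˡ : TE (x ∷ y ∷ Γ) T Δ → TE (y ∷ x ∷ Γ) T Δ
exchangeˡ = reorder swap-≈ ≈-refl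

exchangeʳ : TE Γ T (x ∷ y ∷ Δ) → TE Γ T (y ∷ x ∷ Δ)
exchangeʳ = reorder ≈-refl swap-≈

sharedCut : TE Γ T (x ∷ Δ) → TE (x ∷ Γ) T Δ → TE Γ T Δ
sharedCut d e = reorder (++-absorbˡ-≈ ⊆-refl) (++-absorbˡ-≈ ⊆-refl) (cut′ d e)

cutʳ : TE Γ T (x ∷ Δ) → TE (x ∷ Π) T (y ∷ []) → TE (Π ++ Γ) T (y ∷ Δ)
cutʳ {Γ = Γ} {Δ = Δ} d e = reorder (++-comm-≈ {xs = Γ}) (++-comm-≈ {xs = Δ}) (cut′ d e)

weakenʳ : Γ ⊆ Γ′ → x ∷ Δ ⊆ Δ′ → LabelsIn T Γ′ → LabelsIn T Δ′
        → TE Γ T (x ∷ Δ) → TE Γ′ T Δ′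
weakenʳ Γ⊆Γ′ xΔ⊆Δ′ ℓΓ′ ℓΔ′ d =
  reorder (++-absorbˡ-≈ Γ⊆Γ′)
          (≈-trans (++-absorbˡ-≈ (there ∘ xΔ⊆Δ′ ∘ there)) (absorb-≈ (xΔ⊆Δ′ (here refl))))
          (cut′ d (init′ (tree d) (All.head (succedentLabels d)) ℓΓ′ ℓΔ′))

weakenˡ : x ∷ Γ ⊆ Γ′ → Δ ⊆ Δ′ → LabelsIn T Γ′ → LabelsIn T Δ′
        → TE (x ∷ Γ) T Δ → TE Γ′ T Δ′
weakenˡ xΓ⊆Γ′ Δ⊆Δ′ ℓΓ′ ℓΔ′ d =
  reorder (≈-trans (absorb-≈ (∈-++⁺ˡ (xΓ⊆Γ′ (here refl)))) (++-absorbʳ-≈ (xΓ⊆Γ′ ∘ there)))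
          (++-absorbʳ-≈ Δ⊆Δ′)
          (cut′ (init′ (tree d) (All.head (antecedentLabels d)) ℓΓ′ ℓΔ′) d)

nomBound : Fm → ℕ
nomBound (nom j)  = j
nomBound (var _)  = 0
nomBound ⊥f       = 0
nomBound (φ ⇒ ψ)  = nomBound φ ⊔ nomBound ψ
nomBound (at j φ) = j ⊔ nomBound φ
nomBound (F φ)    = nomBound φ
nomBound (□ φ)    = nomBound φ

labelNomBound : Label → ℕ
labelNomBound (rootL _)     = 0
labelNomBound (child α n _) = n ⊔ labelNomBound α

lfNomBound : LF → ℕ
lfNomBound (α ∶at n , φ) = labelNomBound α ⊔ nomBound (at n φ)

indexBound : Label → ℕ
indexBound (rootL _)     = 0
indexBound (child α _ i) = i ⊔ indexBound α

upperBound : (A → ℕ) → List A → ℕ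
upperBound f = foldr (λ a → f a ⊔_) 0

<-upperBound : (f : A → ℕ) (xs : List A) → upperBound f xs < i → All (λ a → f a < i) xs
<-upperBound f []       _ = []
<-upperBound f (a ∷ xs) h = m⊔n<o⇒m<o (f a) _ h ∷ <-upperBound f xs (m⊔n<o⇒n<o (f a) _ h)

<⇒≡ᵇ≡false : m < n → (m ≡ᵇ n) ≡ false
<⇒≡ᵇ≡false {zero}  {suc _} _         = refl
<⇒≡ᵇ≡false {suc m} {suc n} (s≤s m<n) = <⇒≡ᵇ≡false m<n

∨-false : {p q : Bool} → p ≡ false → q ≡ false → (p ∨ q) ≡ false
∨-false = cong₂ _∨_

∨-false⁻ : {p q : Bool} → (p ∨ q) ≡ false → p ≡ false × q ≡ false
∨-false⁻ e = ∨-conicalˡ _ _ e , ∨-conicalʳ _ _ e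

nomBound-fresh : ∀ φ → nomBound φ < m → NotIn m φ
nomBound-fresh (nom j)  h = <⇒≡ᵇ≡false h
nomBound-fresh (var _)  _ = refl
nomBound-fresh ⊥f       _ = refl
nomBound-fresh (φ ⇒ ψ)  h =
  ∨-false (nomBound-fresh φ (m⊔n<o⇒m<o _ _ h)) (nomBound-fresh ψ (m⊔n<o⇒n<o _ _ h))
nomBound-fresh (at j φ) h =
  ∨-false (<⇒≡ᵇ≡false (m⊔n<o⇒m<o j _ h)) (nomBound-fresh φ (m⊔n<o⇒n<o j _ h))
nomBound-fresh (F φ)    h = nomBound-fresh φ h
nomBound-fresh (□ φ)    h = nomBound-fresh φ h

labelNomBound-fresh : ∀ α → labelNomBound α < m → occL m α ≡ false
labelNomBound-fresh (rootL _)     _ = refl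
labelNomBound-fresh (child α n _) h =
  ∨-false (<⇒≡ᵇ≡false (m⊔n<o⇒m<o n _ h)) (labelNomBound-fresh α (m⊔n<o⇒n<o n _ h))

lfNomBound-fresh : ∀ x → lfNomBound x < m → occLF m x ≡ false
lfNomBound-fresh (α ∶at n , φ) h =
  ∨-false (labelNomBound-fresh α (m⊔n<o⇒m<o (labelNomBound α) _ h))
          (nomBound-fresh (at n φ) (m⊔n<o⇒n<o (labelNomBound α) _ h))

freshNom : List LF → List Label → List LF → Nom
freshNom Γ T Δ = suc (upperBound lfNomBound (Γ ++ Δ) ⊔ upperBound labelNomBound T)

freshNom-fresh : ∀ Γ T Δ → FreshNom (freshNom Γ T Δ) Γ T Δ
freshNom-fresh Γ T Δ = All.++⁻ˡ Γ inΓΔ , All.++⁻ʳ Γ inΓΔ , inT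
  where
  boundΓΔ = upperBound lfNomBound (Γ ++ Δ)
  inΓΔ = All.map (λ {x} → lfNomBound-fresh x)
                 (<-upperBound lfNomBound (Γ ++ Δ) (s≤s (m≤m⊔n boundΓΔ _)))
  inT = All.map (λ {β} → labelNomBound-fresh β)
                (<-upperBound labelNomBound T (s≤s (m≤n⊔m boundΓΔ _)))

freshIndex : List Label → ℕ
freshIndex T = suc (upperBound indexBound T)

freshIndex-∉ : child α n (freshIndex T) ∉ T
freshIndex-∉ {α = α} {T = T} β∈T =
  <-irrefl refl (m⊔n<o⇒m<o (freshIndex T) (indexBound α)
                            (All.lookup (<-upperBound indexBound T ≤-refl) β∈T))

childTree : IsTree T → α ∈ T → IsTree (child α n i ∷ T)
childTree ((r , r∈T , root-unique) , closed) α∈T =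
  (r , there r∈T , λ { k (there p) → root-unique k p }) ,
  λ { _ _ _ (here refl) → there α∈T ; β n i (there p) → there (closed β n i p) }

FR-fresh : (∀ m → TE ((α ∶at n , ⟨F⟩ (nom m)) ∷ Γ) T ((α ∶at m , φ) ∷ Δ))
         → TE Γ T ((α ∶at n , F φ) ∷ Δ)
FR-fresh {α = α} {n = n} {Γ = Γ} {T = T} {φ = φ} {Δ = Δ} d =
  FR (tree dₘ , All.tail (antecedentLabels dₘ) , replaceHead (succedentLabels dₘ))
     (freshNom-fresh Γ T goal) dₘ
  where
  goal = (α ∶at n , F φ) ∷ Δ
  dₘ = d (freshNom Γ T goal)

□R-fresh : IsTree T → α ∈ T → LabelsIn T Γ → LabelsIn T Δ
         → (∀ i → TE Γ (child α n i ∷ T) ((child α n i ∶at n , φ) ∷ Δ))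
         → TE Γ T ((α ∶at n , □ φ) ∷ Δ)
□R-fresh {T = T} t α∈T ℓΓ ℓΔ d = □R (t , ℓΓ , α∈T ∷ ℓΔ) freshIndex-∉ (d (freshIndex T))

infix 4 _≟_

_≟_ : DecidableEquality Fm
nom i ≟ nom j        = map′ (cong nom) (λ { refl → refl }) (i ℕ.≟ j)
var p ≟ var q        = map′ (cong var) (λ { refl → refl }) (p ℕ.≟ q)
⊥f ≟ ⊥f              = yes refl
(φ ⇒ ψ) ≟ (φ′ ⇒ ψ′) =
  map′ (uncurry (cong₂ _⇒_)) (λ { refl → refl , refl }) (φ ≟ φ′ ×-dec ψ ≟ ψ′)
at i φ ≟ at j ψ      = map′ (uncurry (cong₂ at)) (λ { refl → refl , refl }) (i ℕ.≟ j ×-dec φ ≟ ψ)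
F φ ≟ F ψ            = map′ (cong F) (λ { refl → refl }) (φ ≟ ψ)
□ φ ≟ □ ψ            = map′ (cong □) (λ { refl → refl }) (φ ≟ ψ)
nom _ ≟ var _        = no λ ()
nom _ ≟ ⊥f           = no λ ()
nom _ ≟ (_ ⇒ _)      = no λ ()
nom _ ≟ at _ _       = no λ ()
nom _ ≟ F _          = no λ ()
nom _ ≟ □ _          = no λ ()
var _ ≟ nom _        = no λ ()
var _ ≟ ⊥f           = no λ ()
var _ ≟ (_ ⇒ _)      = no λ ()
var _ ≟ at _ _       = no λ ()
var _ ≟ F _          = no λ ()
var _ ≟ □ _          = no λ ()
⊥f ≟ nom _           = no λ ()
⊥f ≟ var _           = no λ ()
⊥f ≟ (_ ⇒ _)         = no λ ()
⊥f ≟ at _ _          = no λ ()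
⊥f ≟ F _             = no λ ()
⊥f ≟ □ _             = no λ ()
(_ ⇒ _) ≟ nom _      = no λ ()
(_ ⇒ _) ≟ var _      = no λ ()
(_ ⇒ _) ≟ ⊥f         = no λ ()
(_ ⇒ _) ≟ at _ _     = no λ ()
(_ ⇒ _) ≟ F _        = no λ ()
(_ ⇒ _) ≟ □ _        = no λ ()
at _ _ ≟ nom _       = no λ ()
at _ _ ≟ var _       = no λ ()
at _ _ ≟ ⊥f          = no λ ()
at _ _ ≟ (_ ⇒ _)     = no λ ()
at _ _ ≟ F _         = no λ ()
at _ _ ≟ □ _         = no λ ()
F _ ≟ nom _          = no λ ()
F _ ≟ var _          = no λ ()
F _ ≟ ⊥f             = no λ ()
F _ ≟ (_ ⇒ _)        = no λ ()
F _ ≟ at _ _         = no λ ()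
F _ ≟ □ _            = no λ ()
□ _ ≟ nom _          = no λ ()
□ _ ≟ var _          = no λ ()
□ _ ≟ ⊥f             = no λ ()
□ _ ≟ (_ ⇒ _)        = no λ ()
□ _ ≟ at _ _         = no λ ()
□ _ ≟ F _            = no λ ()

atoms : Fm → List Fm
atoms ⊥f      = []
atoms (φ ⇒ ψ) = atoms φ ++ atoms ψ
atoms φ       = φ ∷ []

module Kalmar {T} (t : IsTree T) {α} (α∈T : α ∈ T) (k : Nom) where
  open DecMembership _≟_ using (_∈?_)

  ⟦_⟧ : List Fm → List LF
  ⟦_⟧ = map (α ∶at k ,_)

  infix 3 _⊩_
  _⊩_ : List Fm → List Fm → Set
  gs ⊩ ds = TE ⟦ gs ⟧ T ⟦ ds ⟧

  labels : ∀ gs → LabelsIn T ⟦ gs ⟧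
  labels gs = All.map⁺ (All.universal (λ _ → α∈T) gs)

  valuation : List Fm → Fm → Bool
  valuation gs φ = does (φ ∈? gs)

  Signed : Bool → Fm → List Fm → List Fm → Set
  Signed true  φ gs ds = gs ⊩ φ ∷ ds
  Signed false φ gs ds = φ ∷ gs ⊩ ds

  signed-atom : ∀ {gs ds} φ → φ ∈ gs ⊎ φ ∈ ds → Signed (valuation gs φ) φ gs ds
  signed-atom {gs} {ds} φ φ∈gs⊎ds with φ ∈? gs
  ... | yes φ∈gs = reorder (absorb-≈ (∈-map⁺ _ φ∈gs)) ≈-refl (init′ t α∈T (labels gs) (labels ds))
  ... | no  φ∉gs = reorder ≈-refl (absorb-≈ (∈-map⁺ _ φ∈ds)) (init′ t α∈T (labels gs) (labels ds))
    where φ∈ds = [ ⊥-elim ∘ φ∉gs , id ]′ φ∈gs⊎ds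

  signed-⇒ : ∀ {gs ds} p q → Signed p φ gs ds → Signed q ψ gs ds → Signed (not p ∨ q) (φ ⇒ ψ) gs ds
  signed-⇒ {gs = gs} {ds} false q ⊢¬φ _ =
    →R′ (weakenˡ ⊆-refl (xs⊆x∷xs _ _) (α∈T ∷ labels gs) (α∈T ∷ labels ds) ⊢¬φ)
  signed-⇒ {gs = gs} {ds} true true _ ⊢ψ =
    →R′ (weakenʳ (xs⊆x∷xs _ _) ⊆-refl (α∈T ∷ labels gs) (α∈T ∷ labels ds) ⊢ψ)
  signed-⇒ true false ⊢φ ⊢¬ψ = →L′ ⊢φ ⊢¬ψ

  Covers : Fm → List Fm → List Fm → Set
  Covers ψ gs ds = ∀ {φ} → φ ∈ atoms ψ → φ ∈ gs ⊎ φ ∈ ds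

  signed : ∀ ψ {gs ds} → Covers ψ gs ds → Signed (evalB (valuation gs) ψ) ψ gs ds
  signed (nom i)  c = signed-atom (nom i) (c (here refl))
  signed (var p)  c = signed-atom (var p) (c (here refl))
  signed (at i φ) c = signed-atom (at i φ) (c (here refl))
  signed (F φ)    c = signed-atom (F φ) (c (here refl))
  signed (□ φ)    c = signed-atom (□ φ) (c (here refl))
  signed ⊥f {gs} {ds} _ = init⊥′ t α∈T (labels gs) (labels ds)
  signed (φ ⇒ ψ)  c =
    signed-⇒ _ _ (signed φ (c ∘ ∈-++⁺ˡ)) (signed ψ (c ∘ ∈-++⁺ʳ (atoms φ)))

  private
    toLeft : ∀ {as gs ds} → a ∈ b ∷ as ⊎ a ∈ gs ⊎ a ∈ ds → a ∈ as ⊎ a ∈ b ∷ gs ⊎ a ∈ ds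
    toLeft (inj₁ (here p))   = inj₂ (inj₁ (here p))
    toLeft (inj₁ (there p))  = inj₁ p
    toLeft (inj₂ (inj₁ p))   = inj₂ (inj₁ (there p))
    toLeft (inj₂ (inj₂ p))   = inj₂ (inj₂ p)

    toRight : ∀ {as gs ds} → a ∈ b ∷ as ⊎ a ∈ gs ⊎ a ∈ ds → a ∈ as ⊎ a ∈ gs ⊎ a ∈ b ∷ ds
    toRight (inj₁ (here p))  = inj₂ (inj₂ (here p))
    toRight (inj₁ (there p)) = inj₁ p
    toRight (inj₂ (inj₁ p))  = inj₂ (inj₁ p)
    toRight (inj₂ (inj₂ p))  = inj₂ (inj₂ (there p))

  -- The atoms in as are still undecided; each is cut away after deciding
  -- it both ways.
  tautology : Taut ψ → ∀ as {gs ds} → (∀ {φ} → φ ∈ atoms ψ → φ ∈ as ⊎ φ ∈ gs ⊎ φ ∈ ds)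
            → gs ⊩ ψ ∷ ds
  tautology {ψ} taut [] {gs} {ds} c =
    subst (λ p → Signed p ψ gs ds) (taut (valuation gs)) (signed ψ ([ (λ ()) , id ]′ ∘ c))
  tautology taut (_ ∷ as) c =
    sharedCut (exchangeʳ (tautology taut as (toRight ∘ c))) (tautology taut as (toLeft ∘ c))

upd : (Nom → Nom) → Nom → Nom → Nom → Nom
upd τ n k j = if j ≡ᵇ n then k else τ j

≡ᵇ-refl : ∀ n → (n ≡ᵇ n) ≡ true
≡ᵇ-refl zero    = refl
≡ᵇ-refl (suc n) = ≡ᵇ-refl n

upd-same : ∀ τ n k → upd τ n k n ≡ k
upd-same τ n k rewrite ≡ᵇ-refl n = refl

upd-other : ∀ τ k → (j ≡ᵇ n) ≡ false → upd τ n k j ≡ τ j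
upd-other τ k j≢n rewrite j≢n = refl

usub-id : ∀ φ → usub var id φ ≡ φ
usub-id (nom j)  = refl
usub-id (var p)  = refl
usub-id ⊥f       = refl
usub-id (φ ⇒ ψ)  = cong₂ _⇒_ (usub-id φ) (usub-id ψ)
usub-id (at j φ) = cong (at j) (usub-id φ)
usub-id (F φ)    = cong F (usub-id φ)
usub-id (□ φ)    = cong □ (usub-id φ)

usub-∘ : ∀ σ τ σ′ τ′ φ → usub σ τ (usub σ′ τ′ φ) ≡ usub (usub σ τ ∘ σ′) (τ ∘ τ′) φ
usub-∘ σ τ σ′ τ′ (nom j)  = refl
usub-∘ σ τ σ′ τ′ (var p)  = refl
usub-∘ σ τ σ′ τ′ ⊥f       = refl
usub-∘ σ τ σ′ τ′ (φ ⇒ ψ)  = cong₂ _⇒_ (usub-∘ σ τ σ′ τ′ φ) (usub-∘ σ τ σ′ τ′ ψ)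
usub-∘ σ τ σ′ τ′ (at j φ) = cong (at (τ (τ′ j))) (usub-∘ σ τ σ′ τ′ φ)
usub-∘ σ τ σ′ τ′ (F φ)    = cong F (usub-∘ σ τ σ′ τ′ φ)
usub-∘ σ τ σ′ τ′ (□ φ)    = cong □ (usub-∘ σ τ σ′ τ′ φ)

usub-upd : ∀ σ τ k φ → NotIn n φ → usub σ (upd τ n k) φ ≡ usub σ τ φ
usub-upd σ τ k (nom j)  n∉ = cong nom (upd-other τ k n∉)
usub-upd σ τ k (var p)  _  = refl
usub-upd σ τ k ⊥f       _  = refl
usub-upd σ τ k (φ ⇒ ψ)  n∉ = cong₂ _⇒_ (usub-upd σ τ k φ (proj₁ (∨-false⁻ n∉)))
                                        (usub-upd σ τ k ψ (proj₂ (∨-false⁻ n∉)))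
usub-upd σ τ k (at j φ) n∉ = cong₂ at (upd-other τ k (proj₁ (∨-false⁻ n∉)))
                                      (usub-upd σ τ k φ (proj₂ (∨-false⁻ n∉)))
usub-upd σ τ k (F φ)    n∉ = cong F (usub-upd σ τ k φ n∉)
usub-upd σ τ k (□ φ)    n∉ = cong □ (usub-upd σ τ k φ n∉)

[/]-fresh : ∀ φ → NotIn n φ → φ [ k / n ] ≡ φ
[/]-fresh (nom j)  n∉ = cong nom (upd-other id _ n∉)
[/]-fresh (var p)  _  = refl
[/]-fresh ⊥f       _  = refl
[/]-fresh (φ ⇒ ψ)  n∉ = cong₂ _⇒_ ([/]-fresh φ (proj₁ (∨-false⁻ n∉)))
                                  ([/]-fresh ψ (proj₂ (∨-false⁻ n∉)))
[/]-fresh (at j φ) n∉ = cong₂ at (upd-other id _ (proj₁ (∨-false⁻ n∉)))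
                                 ([/]-fresh φ (proj₂ (∨-false⁻ n∉)))
[/]-fresh (F φ)    n∉ = cong F ([/]-fresh φ n∉)
[/]-fresh (□ φ)    n∉ = cong □ ([/]-fresh φ n∉)

evalB-usub : ∀ v σ τ φ → evalB v (usub σ τ φ) ≡ evalB (evalB v ∘ usub σ τ) φ
evalB-usub v σ τ (nom j)  = refl
evalB-usub v σ τ (var p)  = refl
evalB-usub v σ τ ⊥f       = refl
evalB-usub v σ τ (φ ⇒ ψ)  = cong₂ (λ p q → not p ∨ q) (evalB-usub v σ τ φ) (evalB-usub v σ τ ψ)
evalB-usub v σ τ (at j φ) = refl
evalB-usub v σ τ (F φ)    = refl
evalB-usub v σ τ (□ φ)    = refl

Taut-usub : ∀ σ τ → Taut φ → Taut (usub σ τ φ)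
Taut-usub {φ} σ τ taut v = trans (evalB-usub v σ τ φ) (taut _)

usubN : (PropVar → Fm) → (Nom → Nom) → NForm → NForm
usubN σ τ hole        = hole
usubN σ τ (imp ψ L)   = imp (usub σ τ ψ) (usubN σ τ L)
usubN σ τ (atBox j L) = atBox (τ j) (usubN σ τ L)

usub-fill : ∀ σ τ L φ → usub σ τ (fill L φ) ≡ fill (usubN σ τ L) (usub σ τ φ)
usub-fill σ τ hole        φ = refl
usub-fill σ τ (imp ψ L)   φ = cong (usub σ τ ψ ⇒_) (usub-fill σ τ L φ)
usub-fill σ τ (atBox j L) φ = cong (at (τ j) ∘ □) (usub-fill σ τ L φ)

occN : Nom → NForm → Bool
occN n hole        = false
occN n (imp ψ L)   = occ n ψ ∨ occN n L
occN n (atBox j L) = (j ≡ᵇ n) ∨ occN n L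

NotIn-fill : ∀ L → NotIn n (fill L φ) → occN n L ≡ false × NotIn n φ
NotIn-fill hole        n∉ = refl , n∉
NotIn-fill (imp ψ L)   n∉ with ∨-false⁻ n∉
... | n∉ψ , n∉L = let (n∉L′ , n∉φ) = NotIn-fill L n∉L in ∨-false n∉ψ n∉L′ , n∉φ
NotIn-fill (atBox j L) n∉ with ∨-false⁻ n∉
... | j≢n , n∉L = let (n∉L′ , n∉φ) = NotIn-fill L n∉L in ∨-false j≢n n∉L′ , n∉φ

usubN-upd : ∀ σ τ k L → occN n L ≡ false → usubN σ (upd τ n k) L ≡ usubN σ τ L
usubN-upd σ τ k hole        _  = refl
usubN-upd σ τ k (imp ψ L)   n∉ = cong₂ imp (usub-upd σ τ k ψ (proj₁ (∨-false⁻ n∉)))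
                                           (usubN-upd σ τ k L (proj₂ (∨-false⁻ n∉)))
usubN-upd σ τ k (atBox j L) n∉ = cong₂ atBox (upd-other τ k (proj₁ (∨-false⁻ n∉)))
                                             (usubN-upd σ τ k L (proj₂ (∨-false⁻ n∉)))

Derivable : Fm → Set
Derivable φ = ∀ {T} → IsTree T → ∀ {α} → α ∈ T → ∀ k → TE [] T ((α ∶at k , φ) ∷ [])

taut-derivable : Taut φ → Derivable φ
taut-derivable taut t α∈T k = Kalmar.tautology t α∈T k taut _ {[]} {[]} inj₁

nom-refl : IsTree T → α ∈ T → TE [] T ((α ∶at k , nom k) ∷ [])
nom-refl t α∈T = ref=′ (init′ t α∈T [] [])

modusPonens : TE [] T ((α ∶at k , (φ ⇒ ψ)) ∷ []) → TE [] T ((α ∶at k , φ) ∷ [])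
            → TE [] T ((α ∶at k , ψ) ∷ [])
modusPonens ⊢φ⇒ψ ⊢φ =
  cut′ ⊢φ⇒ψ (→L′ (weakenʳ ⊆-refl (xs⊆xs++ys _ _) [] (α∈T ∷ α∈T ∷ []) ⊢φ)
                 (init′ (tree ⊢φ) α∈T [] []))
  where α∈T = All.head (succedentLabels ⊢φ)

⇔-intro : TE ((α ∶at k , φ) ∷ []) T ((α ∶at k , ψ) ∷ [])
        → TE ((α ∶at k , ψ) ∷ []) T ((α ∶at k , φ) ∷ [])
        → TE [] T ((α ∶at k , (φ ⇔f ψ)) ∷ [])
⇔-intro {α = α} {k = k} {T = T} φ⊢ψ ψ⊢φ =
  →R′ (→L′ (→R′ (withFalsum φ⊢ψ)) (→L′ (→R′ (withFalsum ψ⊢φ)) (init⊥′ t α∈T [] (α∈T ∷ []))))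
  where
  t = tree φ⊢ψ
  α∈T = All.head (succedentLabels φ⊢ψ)
  withFalsum : TE ((α ∶at k , φ) ∷ []) T ((α ∶at k , ψ) ∷ [])
             → TE ((α ∶at k , φ) ∷ []) T ((α ∶at k , ψ) ∷ (α ∶at k , ⊥f) ∷ [])
  withFalsum = weakenʳ ⊆-refl (xs⊆xs++ys _ _) (α∈T ∷ []) (α∈T ∷ α∈T ∷ [])

K□-derivable : ∀ φ ψ → Derivable (□ (φ ⇒ ψ) ⇒ (□ φ ⇒ □ ψ))
K□-derivable φ ψ t α∈T k = →R′ (→R′ (□R-fresh t α∈T (α∈T ∷ α∈T ∷ []) [] λ i →
  let tβ = childTree t α∈T ; β∈ = here refl in
  □L′ (there α∈T) β∈ (exchangeˡ (□L′ (there α∈T) β∈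
    (→L′ (init′ tβ β∈ [] (β∈ ∷ [])) (init′ tβ β∈ (β∈ ∷ []) []))))))

KF-derivable : ∀ φ ψ → Derivable (F (φ ⇒ ψ) ⇒ (F φ ⇒ F ψ))
KF-derivable φ ψ t α∈T k = →R′ (→R′ (FR-fresh λ m →
  exchangeˡ (FL′ (init′ t α∈T (α∈T ∷ []) (α∈T ∷ []))
    (reorder rotate-≈ ≈-refl
      (FL′ (exchangeˡ (init′ t α∈T (α∈T ∷ []) (α∈T ∷ [])))
           (→L′ (init′ t α∈T (α∈T ∷ []) (α∈T ∷ [])) (init′ t α∈T (α∈T ∷ α∈T ∷ []) [])))))))

Kat-derivable : ∀ n φ ψ → Derivable (at n (φ ⇒ ψ) ⇒ (at n φ ⇒ at n ψ))
Kat-derivable n φ ψ t α∈T k = →R′ (→R′ (atR′ (atL′ (exchangeˡ (atL′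
  (→L′ (init′ t α∈T [] (α∈T ∷ [])) (init′ t α∈T (α∈T ∷ []) [])))))))

ref-derivable : ∀ n → Derivable (at n (nom n))
ref-derivable n t α∈T k = atR′ (nom-refl t α∈T)

selfDual-derivable : ∀ n φ → Derivable (¬f (at n φ) ⇔f at n (¬f φ))
selfDual-derivable n φ t α∈T k = ⇔-intro
  (atR′ (→R′ (exchangeˡ (→L′ (atR′ (init′ t α∈T [] (α∈T ∷ [])))
                             (init⊥′ t α∈T (α∈T ∷ []) (α∈T ∷ []))))))
  (→R′ (atL′ (exchangeˡ (atL′ (→L′ (init′ t α∈T [] (α∈T ∷ []))
                                   (init⊥′ t α∈T (α∈T ∷ []) (α∈T ∷ [])))))))

-- rep=1 acts on α : @_x φ with x fresh for φ, whose instances for x := k and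
-- x := n are α : @_k φ and α : @_n φ.
intro-derivable : ∀ n φ → Derivable (at n φ ⇒ (nom n ⇒ φ))
intro-derivable n φ {T} t {α} α∈T k = →R′ (→R′ (exchangeˡ (atL′ (exchangeˡ replaced))))
  where
  fresh = suc (nomBound φ)
  template = α ∶at fresh , φ
  named : ∀ j → lfSub template j fresh ≡ (α ∶at j , φ)
  named j = cong₂ (α ∶at_,_) (upd-same id fresh j) ([/]-fresh φ (nomBound-fresh φ ≤-refl))
  Sequent : LF → Set
  Sequent y = TE ((α ∶at k , nom n) ∷ y ∷ []) T ((α ∶at k , φ) ∷ [])
  replaced : Sequent (α ∶at n , φ)
  replaced = subst Sequent (named n)
    (rep=1 {k = fresh} template refl (t , α∈T ∷ α∈T ∷ [] , α∈T ∷ [])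
      (subst Sequent (sym (named k)) (exchangeˡ (init′ t α∈T (α∈T ∷ []) []))))

agree-derivable : ∀ n m φ → Derivable (at n (at m φ) ⇒ at m φ)
agree-derivable n m φ t α∈T k = →R′ (atL′ (atL′ (atR′ (init′ t α∈T [] []))))

back-derivable : ∀ n φ → Derivable (at n φ ⇒ F (at n φ))
back-derivable n φ t α∈T k =
  →R′ (FR-fresh λ m → atR′ (exchangeˡ (atL′ (init′ t α∈T (α∈T ∷ []) []))))

at□-derivable : ∀ n φ → Derivable (at n (□ (at n φ)) ⇔f at n (□ φ))
at□-derivable n φ t α∈T k = ⇔-intro
  (atL′ (atR′ (□R-fresh t α∈T (α∈T ∷ []) [] λ i →
    □L′ (there α∈T) (here refl) (atL′ (init′ (childTree t α∈T) (here refl) [] [])))))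
  (atL′ (atR′ (□R-fresh t α∈T (α∈T ∷ []) [] λ i →
    atR′ (□L′ (there α∈T) (here refl) (init′ (childTree t α∈T) (here refl) [] [])))))

rigid⁺-derivable : ∀ n m → Derivable (at n (nom m) ⇒ □ (at n (nom m)))
rigid⁺-derivable n m t α∈T k = →R′ (□R-fresh t α∈T (α∈T ∷ []) [] λ i →
  atR′ (atL′ (rigid=′ (there α∈T) (here refl) (init′ (childTree t α∈T) (here refl) [] []))))

rigid⁻-derivable : ∀ n m → Derivable (¬f (at n (nom m)) ⇒ □ (¬f (at n (nom m))))
rigid⁻-derivable n m t α∈T k = →R′ (□R-fresh t α∈T (α∈T ∷ []) [] λ i →
  let tβ = childTree t α∈T ; β∈ = here refl in
  →R′ (exchangeˡ (→L′
    (atR′ (atL′ (rigid=′ β∈ (there α∈T) (init′ tβ (there α∈T) [] (β∈ ∷ [])))))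
    (init⊥′ tβ (there α∈T) (β∈ ∷ []) (β∈ ∷ [])))))

→R-inverse : TE Γ T ((α ∶at k , (φ ⇒ ψ)) ∷ Δ)
           → TE ((α ∶at k , φ) ∷ Γ) T ((α ∶at k , ψ) ∷ Δ)
→R-inverse d = cutʳ d (→L′ (init′ t α∈T [] (α∈T ∷ [])) (init′ t α∈T (α∈T ∷ []) []))
  where
  t = tree d
  α∈T = All.head (succedentLabels d)

atR-inverse : TE Γ T ((α ∶at k , at m φ) ∷ Δ) → TE Γ T ((α ∶at m , φ) ∷ Δ)
atR-inverse d = cutʳ d (atL′ (init′ (tree d) (All.head (succedentLabels d)) [] []))

atL-inverse : TE ((α ∶at k , at m φ) ∷ Γ) T Δ → TE ((α ∶at m , φ) ∷ Γ) T Δ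
atL-inverse d = cut′ (atR′ (init′ (tree d) (All.head (antecedentLabels d)) [] [])) d

□R-inverse : child α n i ∈ T → TE Γ T ((α ∶at n , □ φ) ∷ Δ)
           → TE Γ T ((child α n i ∶at n , φ) ∷ Δ)
□R-inverse β∈T d = cutʳ d (□L′ (All.head (succedentLabels d)) β∈T (init′ (tree d) β∈T [] []))

witnessF : Nom → Nom → Fm → Fm
witnessF n m φ = at n (⟨F⟩ (nom m)) ⇒ at m φ

fill-FR : ∀ L → (∀ m → TE Γ T ((α ∶at k , fill L (witnessF n m φ)) ∷ Δ))
        → TE Γ T ((α ∶at k , fill L (at n (F φ))) ∷ Δ)
fill-FR hole        d = atR′ (FR-fresh λ m → atR-inverse (atL-inverse (→R-inverse (d m))))
fill-FR (imp ψ L)   d = →R′ (fill-FR L (→R-inverse ∘ d))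
fill-FR (atBox j L) d =
  atR′ (□R-fresh t α∈T (antecedentLabels d₀) (All.tail (succedentLabels d₀)) λ i →
    fill-FR L λ m → □R-inverse (here refl) (atR-inverse (wlab′ (childTree t α∈T) (d m))))
  where
  d₀ = d 0
  t = tree d₀
  α∈T = All.head (succedentLabels d₀)

usub-witnessF-upd : ∀ σ τ L n m m′ φ → NotIn m (fill L (at n (F φ)))
                  → usub σ (upd τ m m′) (fill L (witnessF n m φ))
                    ≡ fill (usubN σ τ L) (witnessF (τ n) m′ (usub σ τ φ))
usub-witnessF-upd σ τ L n m m′ φ m∉ with NotIn-fill L m∉
... | m∉L , m∉nFφ with ∨-false⁻ m∉nFφ
... | n≢m , m∉φ = begin
  usub σ τ′ (fill L (witnessF n m φ))
    ≡⟨ usub-fill σ τ′ L (witnessF n m φ) ⟩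
  fill (usubN σ τ′ L) (witnessF (τ′ n) (τ′ m) (usub σ τ′ φ))
    ≡⟨ cong₂ fill (usubN-upd σ τ m′ L m∉L)
                  (cong (λ j → witnessF (τ′ n) j (usub σ τ′ φ)) (upd-same τ m m′)) ⟩
  fill (usubN σ τ L) (witnessF (τ′ n) m′ (usub σ τ′ φ))
    ≡⟨ cong (fill (usubN σ τ L))
            (cong₂ (λ j → witnessF j m′) (upd-other τ m′ n≢m) (usub-upd σ τ m′ φ m∉φ)) ⟩
  fill (usubN σ τ L) (witnessF (τ n) m′ (usub σ τ φ)) ∎
  where
  open ≡-Reasoning
  τ′ = upd τ m m′

retype : φ ≡ ψ → TE [] T ((α ∶at k , φ) ∷ []) → TE [] T ((α ∶at k , ψ) ∷ [])
retype {T = T} {α = α} {k = k} = subst (λ χ → TE [] T ((α ∶at k , χ) ∷ []))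

HEFL-derivable : HEFL φ → ∀ σ τ → Derivable (usub σ τ φ)
HEFL-derivable (ax-taut {φ} taut) σ τ = taut-derivable (Taut-usub {φ} σ τ taut)
HEFL-derivable (ax-K□ p q)      σ τ = K□-derivable (σ p) (σ q)
HEFL-derivable (ax-KF p q)      σ τ = KF-derivable (σ p) (σ q)
HEFL-derivable (ax-Kat n p q)   σ τ = Kat-derivable (τ n) (σ p) (σ q)
HEFL-derivable (ax-ref n)       σ τ = ref-derivable (τ n)
HEFL-derivable (ax-selfd n p)   σ τ = selfDual-derivable (τ n) (σ p)
HEFL-derivable (ax-intro n p)   σ τ = intro-derivable (τ n) (σ p)
HEFL-derivable (ax-agree n m p) σ τ = agree-derivable (τ n) (τ m) (σ p)
HEFL-derivable (ax-back n p)    σ τ = back-derivable (τ n) (σ p)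
HEFL-derivable (ax-at□ n p)     σ τ = at□-derivable (τ n) (σ p)
HEFL-derivable (ax-rig+ n m)    σ τ = rigid⁺-derivable (τ n) (τ m)
HEFL-derivable (ax-rig- n m)    σ τ = rigid⁻-derivable (τ n) (τ m)
HEFL-derivable (r-mp d e)       σ τ t α∈T k =
  modusPonens (HEFL-derivable d σ τ t α∈T k) (HEFL-derivable e σ τ t α∈T k)
HEFL-derivable (r-nec□ d)       σ τ t α∈T k =
  □R-fresh t α∈T [] [] λ i → HEFL-derivable d σ τ (childTree t α∈T) (here refl) k
HEFL-derivable (r-necF d)       σ τ t α∈T k =
  FR-fresh λ m → weakenʳ (λ ()) ⊆-refl (α∈T ∷ []) (α∈T ∷ []) (HEFL-derivable d σ τ t α∈T m)
HEFL-derivable (r-necat n d)    σ τ t α∈T k = atR′ (HEFL-derivable d σ τ t α∈T (τ n))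
HEFL-derivable (r-subst {φ} σ′ τ′ d) σ τ t α∈T k =
  retype (sym (usub-∘ σ τ σ′ τ′ φ)) (HEFL-derivable d (usub σ τ ∘ σ′) (τ ∘ τ′) t α∈T k)
HEFL-derivable (r-name {φ} n n∉φ d) σ τ t α∈T k =
  modusPonens (retype (cong₂ _⇒_ (cong nom (upd-same τ n k)) (usub-upd σ τ k φ n∉φ))
                      (HEFL-derivable d σ (upd τ n k) t α∈T k))
              (nom-refl t α∈T)
HEFL-derivable (r-bg L n m φ m∉ d) σ τ t α∈T k =
  retype (sym (usub-fill σ τ L (at n (F φ)))) (fill-FR (usubN σ τ L) λ m′ →
    retype (usub-witnessF-upd σ τ L n m m′ φ m∉) (HEFL-derivable d σ (upd τ m m′) t α∈T k))

-- The nominal need not be fresh for φ.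
theorem4 : (φ : Fm) → HEFL φ
    → (T : List Label) → IsTree T → (α : Label) → α ∈ T
    → (n : Nom) → NotIn n φ
    → TE [] T ((α ∶at n , φ) ∷ [])
theorem4 φ d T t α α∈T n _ = retype (usub-id φ) (HEFL-derivable d var id t α∈T n)
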